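{- The following two statements are equivalent. (A) For every positive integer $k$ and every digraph $D$ of order $n \ge 12k+3$ such that $d_D^+(u)+d_D^-(v)\ge n$ for every two distinct vertices $u,v$ with $(u,v)\notin A(D)$, $D$ has a directed $2$-factor consisting of exactly $k$ directed cycles each of length at least $3$. (B) For every positive integer $k$, every balanced bipartite graph $G$ of order $2n$ with $n\ge 12k+3$ and every perfect matching $M$ of $G$, if $\sigma_{1,1}(G)\ge n+2$ then $G$ has a $2$-factor consisting of exactly $k$ cycles each of length at least $6$ that contains every edge of $M$.
   Context: Digraphs are finite, without loops or multiple arcs (opposite arcs allowed); $A(D)$ is the arc set, $d_D^+$, $d_D^-$ out- and in-degree; a directed $2$-factor is a spanning subdigraph whose components are directed cycles. Graphs are finite and simple; a balanced bipartite graph has partite sets $X,Y$ with $|X|=|Y|$; $\sigma_{1,1}(G)=\min\{d_G(x)+d_G(y): x\in X, y\in Y, xy\notin E(G)\}$ if $G$ is not complete bipartite and $+\infty$ otherwise. A $2$-factor is a spanning subgraph whose components are cycles. -}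

module Defs where

open import Data.Nat using (ℕ; zero; suc; _+_; _*_; _≤_)
open import Data.Fin using (Fin; zero; suc)
open import Data.Bool using (Bool; true; false; if_then_else_)
open import Data.Sum using (_⊎_; inj₁; inj₂)
open import Data.Product using (_×_; Σ; ∃; _,_)
open import Data.Empty using (⊥)
open import Data.Unit using (⊤)
open import Data.List using (List; []; _∷_; _++_; [_]; length; concat; map; allFin)
open import Data.List.Membership.Propositional using (_∈_)
open import Data.List.Relation.Binary.Permutation.Propositional using (_↭_)
open import Relation.Binary.PropositionalEquality using (_≡_; _≢_)
open import Function.Definitions using (Injective)
open import Function using (_∘_)

count : ∀ {n} → (Fin n → Bool) → ℕ
count {zero}  f = 0
count {suc n} f = (if f zero then 1 else 0) + count (f ∘ suc)

Path : ∀ {V : Set} → (V → V → Set) → List V → Set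
Path E []           = ⊤
Path E (x ∷ [])     = ⊤
Path E (x ∷ y ∷ r)  = E x y × Path E (y ∷ r)

ClosedWalk : ∀ {V : Set} → (V → V → Set) → List V → Set
ClosedWalk E []       = ⊥
ClosedWalk E (x ∷ xs) = Path E (x ∷ xs ++ [ x ])

data Step {V : Set} : List V → V → V → Set where
  here  : ∀ {a b r} → Step (a ∷ b ∷ r) a b
  there : ∀ {x r u v} → Step r u v → Step (x ∷ r) u v

CycleEdge : ∀ {V : Set} → List V → V → V → Set
CycleEdge []       u v = ⊥
CycleEdge (x ∷ xs) u v = Step (x ∷ xs ++ [ x ]) u v ⊎ Step (x ∷ xs ++ [ x ]) v u

-- A family of cycles (vertex lists) is a 2-factor-like partition of the
-- vertex list `vs` into exactly k cycles, each of length ≥ ℓ, w.r.t. E.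
-- (Vertices in a cycle are distinct and the cycles are vertex-disjoint
-- and spanning, since their concatenation is a permutation of vs.)
CycleFactor : ∀ {V : Set} → (V → V → Set) → List V → ℕ → ℕ → List (List V) → Set
CycleFactor E vs k ℓ cs =
  (length cs ≡ k) × (concat cs ↭ vs) ×
  (∀ c → c ∈ cs → (ℓ ≤ length c) × ClosedWalk E c)

record Digraph (n : ℕ) : Set where
  field
    arc      : Fin n → Fin n → Bool
    loopless : ∀ v → arc v v ≡ false

module _ {n : ℕ} (D : Digraph n) where
  open Digraph D
  Arc : Fin n → Fin n → Set
  Arc u v = arc u v ≡ true

  outdeg : Fin n → ℕ
  outdeg u = count (λ v → arc u v)

  indeg : Fin n → ℕ
  indeg v = count (λ u → arc u v)

  HasDirected2Factor : ℕ → Set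
  HasDirected2Factor k = Σ (List (List (Fin n))) λ cs → CycleFactor Arc (allFin n) k 3 cs

-- Balanced bipartite graphs with partite sets X = Y = Fin n,
-- given by the biadjacency relation; vertex set Fin n ⊎ Fin n.

record BipGraph (n : ℕ) : Set where
  field
    adj : Fin n → Fin n → Bool

module _ {n : ℕ} (G : BipGraph n) where
  open BipGraph G
  Vtx : Set
  Vtx = Fin n ⊎ Fin n

  Edge : Vtx → Vtx → Set
  Edge (inj₁ x) (inj₂ y) = adj x y ≡ true
  Edge (inj₂ y) (inj₁ x) = adj x y ≡ true
  Edge (inj₁ _) (inj₁ _) = ⊥
  Edge (inj₂ _) (inj₂ _) = ⊥

  degX : Fin n → ℕ
  degX x = count (λ y → adj x y)

  degY : Fin n → ℕ
  degY y = count (λ x → adj x y)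

  -- σ_{1,1}(G) ≥ m  (vacuous when G is complete bipartite, σ = +∞)
  σ₁₁≥ : ℕ → Set
  σ₁₁≥ m = ∀ x y → adj x y ≡ false → m ≤ degX x + degY y

  -- a perfect matching of G: a bijection X → Y (injective map on Fin n)
  -- along edges of G; the matching edges are {x, μ x}.
  record PerfectMatching : Set where
    field
      μ     : Fin n → Fin n
      inj   : Injective _≡_ _≡_ μ
      edges : ∀ x → adj x (μ x) ≡ true

  allVtx : List Vtx
  allVtx = map inj₁ (allFin n) ++ map inj₂ (allFin n)

  Has2FactorWith : ℕ → PerfectMatching → Set
  Has2FactorWith k M = Σ (List (List Vtx)) λ cs →
    CycleFactor Edge allVtx k 6 cs ×
    (∀ x → ∃ λ c → c ∈ cs × CycleEdge c (inj₁ x) (inj₂ (PerfectMatching.μ M x)))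

StatementA : Set
StatementA = ∀ (k : ℕ) → 1 ≤ k → ∀ (n : ℕ) → 12 * k + 3 ≤ n → (D : Digraph n) →
  (∀ u v → u ≢ v → Digraph.arc D u v ≡ false → n ≤ outdeg D u + indeg D v) →
  HasDirected2Factor D k

StatementB : Set
StatementB = ∀ (k : ℕ) → 1 ≤ k → ∀ (n : ℕ) → 12 * k + 3 ≤ n → (G : BipGraph n) →
  (M : PerfectMatching G) → σ₁₁≥ G (n + 2) → Has2FactorWith G k M

module Submission where

-- (B ⇒ A)  Split every vertex v of D into x_v ∈ X and y_v ∈ Y, join x_v y_v
--   (these edges form the matching M) and join y_u x_v for every arc u → v.
--   Degrees grow by one on both sides, so Ore's condition for D becomes
--   σ₁₁(G) ≥ n + 2.  A cycle of G through all its matching edges alternates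
--   x_a y_a x_b y_b … ; read in the matching direction it is the blow-up of a
--   directed cycle a → b → … of D of half its length.
-- (A ⇒ B)  Conversely contract every matching edge x_u y_{μ u} of G to a vertex
--   u, with an arc u → v whenever y_{μ u} x_v is an edge; degrees drop by one and
--   σ₁₁(G) ≥ n + 2 becomes Ore's condition, while blowing up a directed cycle of
--   length ℓ gives a cycle of length 2ℓ of G containing its matching edges.
-- Both reductions keep n and the number k of cycles, so the hypotheses k ≥ 1
-- and n ≥ 12k + 3 are passed through unchanged.

open import Defs
open import Data.Nat using (ℕ; suc; _+_; _≤_; s≤s; z≤n; s≤s⁻¹)
open import Data.Nat.Properties using (+-comm; +-suc; +-mono-≤; +-monoˡ-≤; +-cancelʳ-≤; ≤-reflexive; module ≤-Reasoning)
open import Data.Nat.ListAction using (sum)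
open import Data.Nat.ListAction.Properties using (sum-↭)
open import Data.Fin using (Fin; zero; suc; _≟_)
open import Data.Bool using (Bool; true; false; if_then_else_; _∧_; _∨_; not)
open import Data.Sum using (_⊎_; inj₁; inj₂)
import Data.Sum as Sum
open import Data.Sum.Properties using (inj₁-injective; inj₂-injective)
open import Data.Product using (_×_; Σ; ∃; ∃₂; _,_; proj₁; proj₂)
open import Data.Empty using (⊥; ⊥-elim)
open import Data.Unit using (tt)
open import Data.List using (List; []; _∷_; _++_; [_]; length; concat; map; reverse; tabulate; allFin)
open import Data.List.Properties using (++-assoc; length-map; length-tabulate; map-tabulate; unfold-reverse; reverse-++)
open import Data.List.Membership.Propositional using (_∈_; _∉_; find)
open import Data.List.Membership.Propositional.Properties
  using (∈-allFin; ∈-map⁻; ∈-map⁺; ∈-concat⁻; ∈-concat⁺′; ∈-++⁻; ∈-++⁺ˡ; ∈-++⁺ʳ; ∈-∃++)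
open import Data.List.Relation.Unary.Any using (here; there)
import Data.List.Relation.Unary.All as All
import Data.List.Relation.Unary.All.Properties as All
open import Data.List.Relation.Unary.AllPairs using ([]; _∷_)
open import Data.List.Relation.Unary.Unique.Propositional using (Unique)
import Data.List.Relation.Unary.Unique.Propositional.Properties as Unique
open import Data.List.Relation.Binary.Permutation.Propositional
  using (_↭_; ↭-refl; ↭-sym; ↭-trans; ↭-prep; ↭-swap; ↭-reflexive; ↭⇒↭ₛ)
import Data.List.Relation.Binary.Permutation.Propositional as Perm
open import Data.List.Relation.Binary.Permutation.Propositional.Properties
  using (∈-resp-↭; ↭-length; shift; ++⁺; ↭-reverse; ∷↭∷ʳ) renaming (map⁺ to ↭-map⁺)
import Data.List.Relation.Binary.Permutation.Setoid.Properties as PermSetoid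
open import Relation.Binary.PropositionalEquality
  using (_≡_; _≢_; refl; sym; trans; cong; cong₂; subst; subst₂; setoid; module ≡-Reasoning)
open import Relation.Nullary using (does)
open import Relation.Nullary.Decidable using (dec-true; dec-false)
open import Function using (_∘_)
open import Function.Bundles using (_⇔_; mk⇔)
open import Function.Definitions using (Injective)

module _ {A : Set} where

  unique-resp-↭ : ∀ {xs ys : List A} → xs ↭ ys → Unique xs → Unique ys
  unique-resp-↭ p = PermSetoid.Unique-resp-↭ (setoid A) (↭⇒↭ₛ p)

  unique-++ˡ : ∀ xs {ys : List A} → Unique (xs ++ ys) → Unique xs
  unique-++ˡ []       _        = []
  unique-++ˡ (_ ∷ xs) (px ∷ u) = All.++⁻ˡ xs px ∷ unique-++ˡ xs u

  unique-++ʳ : ∀ xs {ys : List A} → Unique (xs ++ ys) → Unique ys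
  unique-++ʳ []       u       = u
  unique-++ʳ (_ ∷ xs) (_ ∷ u) = unique-++ʳ xs u

  unique-++-disjoint : ∀ xs {ys : List A} {x} → Unique (xs ++ ys) → x ∈ xs → x ∈ ys → ⊥
  unique-++-disjoint (_ ∷ xs) (px ∷ _) (here refl) m = All.lookup (All.++⁻ʳ xs px) m refl
  unique-++-disjoint (_ ∷ xs) (_ ∷ u)  (there m′)  m = unique-++-disjoint xs u m′ m

  unique-concat : ∀ {xss : List (List A)} {xs} → Unique (concat xss) → xs ∈ xss → Unique xs
  unique-concat {xs ∷ _} u (here refl) = unique-++ˡ xs u
  unique-concat {ys ∷ _} u (there m)   = unique-concat (unique-++ʳ ys u) m

  unique-concat-block : ∀ {xss : List (List A)} {xs ys x} → Unique (concat xss) →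
                        xs ∈ xss → ys ∈ xss → x ∈ xs → x ∈ ys → xs ≡ ys
  unique-concat-block         u (here refl) (here refl) _ _ = refl
  unique-concat-block {zs ∷ _} u (here refl) (there q)   m m′ =
    ⊥-elim (unique-++-disjoint zs u m (∈-concat⁺′ m′ q))
  unique-concat-block {zs ∷ _} u (there p)   (here refl) m m′ =
    ⊥-elim (unique-++-disjoint zs u m′ (∈-concat⁺′ m p))
  unique-concat-block {zs ∷ _} u (there p)   (there q)   m m′ =
    unique-concat-block (unique-++ʳ zs u) p q m m′

  unique-⊆-length⇒↭ : ∀ (xs ys : List A) → Unique xs → (∀ {y} → y ∈ xs → y ∈ ys) →
                      length ys ≤ length xs → xs ↭ ys
  unique-⊆-length⇒↭ []       []       _        _   _  = ↭-refl
  unique-⊆-length⇒↭ (x ∷ xs) ys (px ∷ u) sub le with ∈-∃++ (sub (here refl))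
  ... | ws , zs , refl =
    ↭-trans (↭-prep x (unique-⊆-length⇒↭ xs (ws ++ zs) u sub′ le′)) (↭-sym (shift x ws zs))
    where
    sub′ : ∀ {y} → y ∈ xs → y ∈ ws ++ zs
    sub′ {y} m with ∈-++⁻ ws (sub (there m))
    ... | inj₁ m-ws          = ∈-++⁺ˡ m-ws
    ... | inj₂ (here refl)   = ⊥-elim (All.lookup px m refl)
    ... | inj₂ (there m-zs)  = ∈-++⁺ʳ ws m-zs
    le′ : length (ws ++ zs) ≤ length xs
    le′ = s≤s⁻¹ (subst (_≤ suc (length xs)) (↭-length (shift x ws zs)) le)

injection-↭ : ∀ {n} {μ : Fin n → Fin n} → Injective _≡_ _≡_ μ → tabulate μ ↭ allFin n
injection-↭ {n} {μ} inj =
  unique-⊆-length⇒↭ (tabulate μ) (allFin n) (Unique.tabulate⁺ inj) (λ {y} _ → ∈-allFin y)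
    (≤-reflexive (trans (length-tabulate (λ i → i)) (sym (length-tabulate μ))))

indicator : Bool → ℕ
indicator b = if b then 1 else 0

count-tabulate : ∀ {A : Set} {n} (f : A → Bool) (h : Fin n → A) →
                 count (f ∘ h) ≡ sum (map (indicator ∘ f) (tabulate h))
count-tabulate {n = 0}     f h = refl
count-tabulate {n = suc n} f h = cong (indicator (f (h zero)) +_) (count-tabulate f (h ∘ suc))

count-∘-injection : ∀ {n} (f : Fin n → Bool) {μ : Fin n → Fin n} →
                    Injective _≡_ _≡_ μ → count (f ∘ μ) ≡ count f
count-∘-injection {n} f {μ} inj = begin
  count (f ∘ μ)                                ≡⟨ count-tabulate f μ ⟩
  sum (map (indicator ∘ f) (tabulate μ))       ≡⟨ sum-↭ (↭-map⁺ (indicator ∘ f) (injection-↭ inj)) ⟩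
  sum (map (indicator ∘ f) (allFin n))         ≡⟨ count-tabulate f (λ i → i) ⟨
  count f                                      ∎
  where open ≡-Reasoning

count-ext : ∀ {n} {f g : Fin n → Bool} → (∀ i → f i ≡ g i) → count f ≡ count g
count-ext {0}     _ = refl
count-ext {suc n} e = cong₂ _+_ (cong indicator (e zero)) (count-ext (e ∘ suc))

count-drop-one : ∀ {n} (f g : Fin n → Bool) (x : Fin n) → (∀ i → i ≢ x → f i ≡ g i) →
                 f x ≡ true → g x ≡ false → count f ≡ suc (count g)
count-drop-one f g zero agree fx gx rewrite fx | gx =
  cong suc (count-ext (λ i → agree (suc i) (λ ())))
count-drop-one f g (suc x) agree fx gx rewrite agree zero (λ ()) =
  trans (cong (indicator (g zero) +_) (count-drop-one (f ∘ suc) (g ∘ suc) x agree′ fx gx))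
        (+-suc (indicator (g zero)) (count (g ∘ suc)))
  where
  agree′ : ∀ i → i ≢ x → f (suc i) ≡ g (suc i)
  agree′ i i≢x = agree (suc i) (λ { refl → i≢x refl })

_==_ : ∀ {n} → Fin n → Fin n → Bool
u == v = does (u ≟ v)

==-refl : ∀ {n} (u : Fin n) → (u == u) ≡ true
==-refl u = dec-true (u ≟ u) refl

==-≢ : ∀ {n} {u v : Fin n} → u ≢ v → (u == v) ≡ false
==-≢ {u = u} {v} = dec-false (u ≟ v)

==-false⇒≢ : ∀ {n} {u v : Fin n} → (u == v) ≡ false → u ≢ v
==-false⇒≢ {u = u} eq refl with () ← trans (sym (==-refl u)) eq

-- The two matching edges account for the shift by 2 between the degree
-- conditions of (A) and (B).
suc+suc : ∀ a b → suc a + suc b ≡ (a + b) + 2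
suc+suc a b = trans (cong suc (+-suc a b)) (+-comm 2 (a + b))

-- A cycle of length 2ℓ ≥ 6 of G comes from a directed cycle of length ℓ ≥ 3.
half : ∀ l → 6 ≤ l + l → 3 ≤ l
half 0 ()
half 1 (s≤s (s≤s ()))
half 2 (s≤s (s≤s (s≤s (s≤s ()))))
half (suc (suc (suc l))) _ = s≤s (s≤s (s≤s z≤n))

module _ {V : Set} {E : V → V → Set} where

  path-prefix : ∀ l r → Path E (l ++ r) → Path E l
  path-prefix []          _ _       = tt
  path-prefix (_ ∷ [])    _ _       = tt
  path-prefix (x ∷ y ∷ l) r (e , p) = e , path-prefix (y ∷ l) r p

  path-join : ∀ l x r → Path E (l ++ [ x ]) → Path E (x ∷ r) → Path E (l ++ x ∷ r)
  path-join []          _ _ _       q = q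
  path-join (_ ∷ [])    _ _ (e , _) q = e , q
  path-join (a ∷ b ∷ l) x r (e , p) q = e , path-join (b ∷ l) x r p q

  path-reverse : (∀ {a b} → E a b → E b a) → ∀ l → Path E l → Path E (reverse l)
  path-reverse sym-E []          _       = tt
  path-reverse sym-E (_ ∷ [])    _       = tt
  path-reverse sym-E (x ∷ y ∷ l) (e , p) =
    subst (Path E) reverse-eq
      (path-join (reverse l) y [ x ]
        (subst (Path E) (unfold-reverse y l) (path-reverse sym-E (y ∷ l) p)) (sym-E e , tt))
    where
    open ≡-Reasoning
    reverse-eq : reverse l ++ y ∷ [ x ] ≡ reverse (x ∷ y ∷ l)
    reverse-eq = begin
      reverse l ++ [ y ] ++ [ x ]   ≡⟨ ++-assoc (reverse l) [ y ] [ x ] ⟨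
      (reverse l ++ [ y ]) ++ [ x ] ≡⟨ cong (_++ [ x ]) (unfold-reverse y l) ⟨
      reverse (y ∷ l) ++ [ x ]      ≡⟨ unfold-reverse x (y ∷ l) ⟨
      reverse (x ∷ y ∷ l)           ∎

module _ {V : Set} where

  step-∈ˡ : ∀ {l : List V} {u v} → Step l u v → u ∈ l
  step-∈ˡ here      = here refl
  step-∈ˡ (there s) = there (step-∈ˡ s)

  step-∈ʳ : ∀ {x} {l : List V} {u v} → Step (x ∷ l) u v → v ∈ l
  step-∈ʳ here                = here refl
  step-∈ʳ {l = _ ∷ _} (there s) = there (step-∈ʳ s)

  step-∈-init : ∀ (l : List V) {x u v} → Step (l ++ [ x ]) u v → u ∈ l
  step-∈-init []          (there ())
  step-∈-init (_ ∷ [])    here              = here refl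
  step-∈-init (_ ∷ _ ∷ _) here              = here refl
  step-∈-init (_ ∷ l)     (there s)         = there (step-∈-init l s)

  step-++ : ∀ {l : List V} r {u v} → Step l u v → Step (l ++ r) u v
  step-++ r here      = here
  step-++ r (there s) = there (step-++ r s)

  step-mid : ∀ (p : List V) {u v q} → Step (p ++ u ∷ v ∷ q) u v
  step-mid []      = here
  step-mid (_ ∷ p) = there (step-mid p)

  step-drop : ∀ {w} {l : List V} {u v} → Step (w ∷ l) u v → u ≢ w → Step l u v
  step-drop here      u≢w = ⊥-elim (u≢w refl)
  step-drop (there s) _   = s

  step-split : ∀ {l : List V} {u v} → Step l u v → ∃₂ λ p q → l ≡ p ++ u ∷ v ∷ q
  step-split (here {r = r}) = [] , r , refl
  step-split (there {x = x} s) with p , q , eq ← step-split s = x ∷ p , q , cong (x ∷_) eq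

  step-reverse : ∀ {l : List V} {u v} → Step l u v → Step (reverse l) v u
  step-reverse {u = u} {v} s with p , q , refl ← step-split s =
    subst (λ l → Step l v u) (sym reverse-eq) (step-mid (reverse q))
    where
    open ≡-Reasoning
    reverse-eq : reverse (p ++ u ∷ v ∷ q) ≡ reverse q ++ v ∷ u ∷ reverse p
    reverse-eq = begin
      reverse (p ++ u ∷ v ∷ q)                   ≡⟨ reverse-++ p (u ∷ v ∷ q) ⟩
      reverse (u ∷ v ∷ q) ++ reverse p           ≡⟨ cong (_++ reverse p) (unfold-reverse u (v ∷ q)) ⟩
      (reverse (v ∷ q) ++ [ u ]) ++ reverse p    ≡⟨ cong (λ z → (z ++ [ u ]) ++ reverse p) (unfold-reverse v q) ⟩
      ((reverse q ++ [ v ]) ++ [ u ]) ++ reverse p ≡⟨ ++-assoc (reverse q ++ [ v ]) [ u ] (reverse p) ⟩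
      (reverse q ++ [ v ]) ++ u ∷ reverse p      ≡⟨ ++-assoc (reverse q) [ v ] (u ∷ reverse p) ⟩
      reverse q ++ v ∷ u ∷ reverse p             ∎

  closed-reverse : ∀ (x : V) r → reverse (x ∷ r ++ [ x ]) ≡ x ∷ reverse r ++ [ x ]
  closed-reverse x r = trans (unfold-reverse x (r ++ [ x ])) (cong (_++ [ x ]) (reverse-++ r [ x ]))

  closedWalk-rotate : ∀ {E : V → V → Set} x y r → ClosedWalk E (x ∷ y ∷ r) → ClosedWalk E (y ∷ r ++ [ x ])
  closedWalk-rotate {E} x y r (e , p) =
    subst (λ l → Path E (y ∷ l)) (sym (++-assoc r [ x ] [ y ])) (path-join (y ∷ r) x [ y ] p (e , tt))

  closedWalk-reverse : ∀ {E : V → V → Set} → (∀ {a b} → E a b → E b a) →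
                       ∀ x r → ClosedWalk E (x ∷ r) → ClosedWalk E (x ∷ reverse r)
  closedWalk-reverse {E} sym-E x r w =
    subst (Path E) (closed-reverse x r) (path-reverse sym-E (x ∷ r ++ [ x ]) w)

  cycleEdge-rotate : ∀ x y r {u v} → CycleEdge (x ∷ y ∷ r) u v → CycleEdge (y ∷ r ++ [ x ]) u v
  cycleEdge-rotate x y r = Sum.map rotate rotate
    where
    rotate : ∀ {u v} → Step (x ∷ y ∷ r ++ [ x ]) u v → Step (y ∷ (r ++ [ x ]) ++ [ y ]) u v
    rotate here      = subst (λ l → Step (y ∷ l) x y) (sym (++-assoc r [ x ] [ y ])) (step-mid (y ∷ r))
    rotate (there s) = step-++ [ y ] s

  cycleEdge-reverse : ∀ x r {u v} → CycleEdge (x ∷ r) u v → CycleEdge (x ∷ reverse r) u v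
  cycleEdge-reverse x r = Sum.swap ∘ Sum.map reversed reversed
    where
    reversed : ∀ {u v} → Step (x ∷ r ++ [ x ]) u v → Step (x ∷ reverse r ++ [ x ]) v u
    reversed s = subst (λ l → Step l _ _) (closed-reverse x r) (step-reverse s)

  cycleEdge-∈ : ∀ {c : List V} {u v} → CycleEdge c u v → u ∈ c
  cycleEdge-∈ {x ∷ r} {u} e = closed⇒∈ (Sum.[ step-∈ˡ , there ∘ step-∈ʳ ] e)
    where
    closed⇒∈ : u ∈ x ∷ r ++ [ x ] → u ∈ x ∷ r
    closed⇒∈ (here eq) = here eq
    closed⇒∈ (there m) with ∈-++⁻ r m
    ... | inj₁ m-r       = there m-r
    ... | inj₂ (here eq) = here eq

-- Blowing up a vertex sequence of a digraph along a matching μ: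
-- a b c … ↦ x_a y_{μ a} x_b y_{μ b} x_c y_{μ c} …

module _ {n : ℕ} where

  blowUp : (Fin n → Fin n) → List (Fin n) → List (Fin n ⊎ Fin n)
  blowUp μ []      = []
  blowUp μ (a ∷ d) = inj₁ a ∷ inj₂ (μ a) ∷ blowUp μ d

  blowUp-++ : ∀ μ d e → blowUp μ (d ++ e) ≡ blowUp μ d ++ blowUp μ e
  blowUp-++ μ []      e = refl
  blowUp-++ μ (a ∷ d) e = cong (λ l → inj₁ a ∷ inj₂ (μ a) ∷ l) (blowUp-++ μ d e)

  length-blowUp : ∀ μ d → length (blowUp μ d) ≡ length d + length d
  length-blowUp μ []      = refl
  length-blowUp μ (a ∷ d) =
    cong suc (trans (cong suc (length-blowUp μ d)) (sym (+-suc (length d) (length d))))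

  blowUp-concat : ∀ μ ds → concat (map (blowUp μ) ds) ≡ blowUp μ (concat ds)
  blowUp-concat μ []       = refl
  blowUp-concat μ (d ∷ ds) = trans (cong (blowUp μ d ++_) (blowUp-concat μ ds)) (sym (blowUp-++ μ d (concat ds)))

  xSide : List (Fin n ⊎ Fin n) → List (Fin n)
  xSide []           = []
  xSide (inj₁ a ∷ l) = a ∷ xSide l
  xSide (inj₂ _ ∷ l) = xSide l

  xSide-↭ : ∀ {l l′} → l ↭ l′ → xSide l ↭ xSide l′
  xSide-↭ Perm.refl                        = ↭-refl
  xSide-↭ (Perm.prep (inj₁ a) p)           = ↭-prep a (xSide-↭ p)
  xSide-↭ (Perm.prep (inj₂ _) p)           = xSide-↭ p
  xSide-↭ (Perm.swap (inj₁ a) (inj₁ b) p)  = ↭-swap a b (xSide-↭ p)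
  xSide-↭ (Perm.swap (inj₁ a) (inj₂ _) p)  = ↭-prep a (xSide-↭ p)
  xSide-↭ (Perm.swap (inj₂ _) (inj₁ b) p)  = ↭-prep b (xSide-↭ p)
  xSide-↭ (Perm.swap (inj₂ _) (inj₂ _) p)  = xSide-↭ p
  xSide-↭ (Perm.trans p q)                 = ↭-trans (xSide-↭ p) (xSide-↭ q)

  xSide-blowUp : ∀ μ d → xSide (blowUp μ d) ≡ d
  xSide-blowUp μ []      = refl
  xSide-blowUp μ (a ∷ d) = cong (a ∷_) (xSide-blowUp μ d)

  xSide-parts : ∀ (xs ys : List (Fin n)) → xSide (map inj₁ xs ++ map inj₂ ys) ≡ xs
  xSide-parts (x ∷ xs) ys       = cong (x ∷_) (xSide-parts xs ys)
  xSide-parts []       []       = refl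
  xSide-parts []       (_ ∷ ys) = xSide-parts [] ys

-- (A ⇒ B): contracting the matching edges of a balanced bipartite graph

module Contraction {n : ℕ} (G : BipGraph n) (M : PerfectMatching G) where
  open BipGraph G
  open PerfectMatching M

  D : Digraph n
  D = record
    { arc      = λ u v → not (u == v) ∧ adj v (μ u)
    ; loopless = λ v → cong (λ b → not b ∧ adj v (μ v)) (==-refl v)
    }

  arc-off-diagonal : ∀ {u v} → u ≢ v → Digraph.arc D u v ≡ adj v (μ u)
  arc-off-diagonal {u} {v} u≢v = cong (λ b → not b ∧ adj v (μ u)) (==-≢ u≢v)

  arc⇒adj : ∀ {u v} → Arc D u v → adj v (μ u) ≡ true
  arc⇒adj {u} {v} a with u == v
  ... | false = a

  degY≡1+outdeg : ∀ u → degY G (μ u) ≡ suc (outdeg D u)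
  degY≡1+outdeg u = count-drop-one (λ x → adj x (μ u)) (Digraph.arc D u) u
    (λ i i≢u → sym (arc-off-diagonal (λ u≡i → i≢u (sym u≡i))))
    (edges u)
    (Digraph.loopless D u)

  degX≡1+indeg : ∀ v → degX G v ≡ suc (indeg D v)
  degX≡1+indeg v = trans (sym (count-∘-injection (adj v) inj))
    (count-drop-one (λ u → adj v (μ u)) (λ u → Digraph.arc D u v) v
      (λ i i≢v → sym (arc-off-diagonal i≢v))
      (edges v)
      (Digraph.loopless D v))

  -- σ₁₁(G) ≥ n + 2 gives Ore's condition for D: a non-arc u → v is a non-edge x_v y_{μ u}.
  ore : σ₁₁≥ G (n + 2) → ∀ u v → u ≢ v → Digraph.arc D u v ≡ false → n ≤ outdeg D u + indeg D v
  ore σ u v u≢v no-arc = +-cancelʳ-≤ 2 n (outdeg D u + indeg D v) (begin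
    n + 2                                   ≤⟨ σ v (μ u) (trans (sym (arc-off-diagonal u≢v)) no-arc) ⟩
    degX G v + degY G (μ u)                 ≡⟨ +-comm (degX G v) (degY G (μ u)) ⟩
    degY G (μ u) + degX G v                 ≡⟨ cong₂ _+_ (degY≡1+outdeg u) (degX≡1+indeg v) ⟩
    suc (outdeg D u) + suc (indeg D v)      ≡⟨ suc+suc (outdeg D u) (indeg D v) ⟩
    outdeg D u + indeg D v + 2              ∎)
    where open ≤-Reasoning

  blowUp-path : ∀ a m → Path (Arc D) (a ∷ m) → Path (Edge G) (blowUp μ (a ∷ m))
  blowUp-path a []      _       = edges a , tt
  blowUp-path a (b ∷ m) (e , p) = edges a , arc⇒adj e , blowUp-path b m p

  blowUp-closedWalk : ∀ d → ClosedWalk (Arc D) d → ClosedWalk (Edge G) (blowUp μ d)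
  blowUp-closedWalk (a ∷ d) w =
    path-prefix (inj₁ a ∷ inj₂ (μ a) ∷ blowUp μ d ++ [ inj₁ a ]) [ inj₂ (μ a) ]
      (subst (Path (Edge G)) unfold (blowUp-path a (d ++ [ a ]) w))
    where
    unfold : blowUp μ (a ∷ d ++ [ a ]) ≡ (inj₁ a ∷ inj₂ (μ a) ∷ blowUp μ d ++ [ inj₁ a ]) ++ [ inj₂ (μ a) ]
    unfold = cong (λ l → inj₁ a ∷ inj₂ (μ a) ∷ l)
      (trans (blowUp-++ μ d [ a ]) (sym (++-assoc (blowUp μ d) [ inj₁ a ] [ inj₂ (μ a) ])))

  blowUp-matchingStep : ∀ {x d} → x ∈ d → Step (blowUp μ d) (inj₁ x) (inj₂ (μ x))
  blowUp-matchingStep (here refl) = here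
  blowUp-matchingStep (there m)   = there (there (blowUp-matchingStep m))

  blowUp-spanning : ∀ {l} → l ↭ allFin n → blowUp μ l ↭ allVtx G
  blowUp-spanning {l} l↭all = ↭-trans (separate l)
    (++⁺ (↭-map⁺ inj₁ l↭all)
         (↭-map⁺ inj₂ (↭-trans (↭-map⁺ μ l↭all)
                               (subst (_↭ allFin n) (sym (map-tabulate (λ i → i) μ)) (injection-↭ inj)))))
    where
    separate : ∀ d → blowUp μ d ↭ map inj₁ d ++ map inj₂ (map μ d)
    separate []      = ↭-refl
    separate (a ∷ d) = ↭-prep (inj₁ a)
      (↭-trans (↭-prep (inj₂ (μ a)) (separate d)) (↭-sym (shift (inj₂ (μ a)) (map inj₁ d) (map inj₂ (map μ d)))))

  lift : ∀ k → HasDirected2Factor D k → Has2FactorWith G k M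
  lift k (ds , len , spanning , cycles) =
    map (blowUp μ) ds ,
    (trans (length-map (blowUp μ) ds) len ,
     subst (_↭ allVtx G) (sym (blowUp-concat μ ds)) (blowUp-spanning spanning) ,
     blownUpCycles) ,
    containsM
    where
    blownUpCycles : ∀ c → c ∈ map (blowUp μ) ds → (6 ≤ length c) × ClosedWalk (Edge G) c
    blownUpCycles c m with d , d∈ds , refl ← ∈-map⁻ (blowUp μ) m =
      subst (6 ≤_) (sym (length-blowUp μ d)) (+-mono-≤ (proj₁ (cycles d d∈ds)) (proj₁ (cycles d d∈ds))) ,
      blowUp-closedWalk d (proj₂ (cycles d d∈ds))
    containsM : ∀ x → ∃ λ c → c ∈ map (blowUp μ) ds × CycleEdge c (inj₁ x) (inj₂ (μ x))
    containsM x with (a ∷ d) , d∈ds , x∈d ← find (∈-concat⁻ ds (∈-resp-↭ (↭-sym spanning) (∈-allFin x))) =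
      blowUp μ (a ∷ d) , ∈-map⁺ (blowUp μ) d∈ds , inj₁ (step-++ [ inj₁ a ] (blowUp-matchingStep x∈d))

fromA : StatementA → StatementB
fromA A k k≥1 n n≥12k+3 G M σ =
  Contraction.lift G M k (A k k≥1 n n≥12k+3 (Contraction.D G M) (Contraction.ore G M σ))

-- (B ⇒ A): splitting the vertices of a digraph

module Splitting {n : ℕ} (D : Digraph n) where
  open Digraph D

  G : BipGraph n
  G = record { adj = λ x y → (x == y) ∨ arc y x }

  M : PerfectMatching G
  M = record { μ = λ x → x ; inj = λ eq → eq ; edges = λ x → cong (_∨ arc x x) (==-refl x) }

  V : Set
  V = Vtx G

  split : List (Fin n) → List V
  split = blowUp (λ x → x)

  degX≡1+indeg : ∀ x → degX G x ≡ suc (indeg D x)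
  degX≡1+indeg x = count-drop-one (BipGraph.adj G x) (λ u → arc u x) x
    (λ i i≢x → cong (_∨ arc i x) (==-≢ (λ x≡i → i≢x (sym x≡i))))
    (PerfectMatching.edges M x)
    (loopless x)

  degY≡1+outdeg : ∀ y → degY G y ≡ suc (outdeg D y)
  degY≡1+outdeg y = count-drop-one (λ x → BipGraph.adj G x y) (arc y) y
    (λ i i≢y → cong (_∨ arc y i) (==-≢ i≢y))
    (PerfectMatching.edges M y)
    (loopless y)

  non-edge : ∀ {x y} → BipGraph.adj G x y ≡ false → (x ≢ y) × (arc y x ≡ false)
  non-edge {x} {y} eq with x == y in x==y | arc y x
  ... | false | false = ==-false⇒≢ x==y , refl

  σ₁₁-bound : (∀ u v → u ≢ v → arc u v ≡ false → n ≤ outdeg D u + indeg D v) → σ₁₁≥ G (n + 2)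
  σ₁₁-bound ore x y no-edge with x≢y , no-arc ← non-edge no-edge = begin
    n + 2                               ≤⟨ +-monoˡ-≤ 2 (ore y x (λ y≡x → x≢y (sym y≡x)) no-arc) ⟩
    outdeg D y + indeg D x + 2          ≡⟨ suc+suc (outdeg D y) (indeg D x) ⟨
    suc (outdeg D y) + suc (indeg D x)  ≡⟨ cong₂ _+_ (degY≡1+outdeg y) (degX≡1+indeg x) ⟨
    degY G y + degX G x                 ≡⟨ +-comm (degY G y) (degX G x) ⟩
    degX G x + degY G y                 ∎
    where open ≤-Reasoning

  edge⇒arc : ∀ {b p} → b ≢ p → BipGraph.adj G b p ≡ true → Arc D p b
  edge⇒arc {b} {p} b≢p e = trans (sym (cong (_∨ arc p b) (==-≢ b≢p))) e

  edge-sym : ∀ {u v : V} → Edge G u v → Edge G v u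
  edge-sym {inj₁ _} {inj₂ _} e = e
  edge-sym {inj₂ _} {inj₁ _} e = e

  MateStep : List V → Fin n → Set
  MateStep W b = Step W (inj₁ b) (inj₂ b) ⊎ Step W (inj₂ b) (inj₁ b)

  -- In y_p x_b y_z T with p ≠ b and x_b not repeated in T, the only matching
  -- edge that can be traversed at x_b is x_b y_z; hence z = b.
  mate-follows : ∀ {p b z T} → inj₁ b ∉ T → p ≢ b → MateStep (inj₂ p ∷ inj₁ b ∷ inj₂ z ∷ T) b → z ≡ b
  mate-follows b∉T p≢b (inj₁ (there here))        = refl
  mate-follows b∉T p≢b (inj₁ (there (there s)))   with step-∈ˡ s
  ... | there b∈T = ⊥-elim (b∉T b∈T)
  mate-follows b∉T p≢b (inj₂ here)                = ⊥-elim (p≢b refl)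
  mate-follows b∉T p≢b (inj₂ (there (there s)))   = ⊥-elim (b∉T (step-∈ʳ s))

  segment : Fin n → List V → Fin n → List V
  segment p Q a = inj₂ p ∷ Q ++ [ inj₁ a ]

  decodeSegment : ∀ p Q a → inj₁ a ∉ Q → inj₁ p ∉ Q → (Q ≡ [] → p ≢ a) → Unique Q →
                  (∀ b → inj₁ b ∈ Q → MateStep (segment p Q a) b) → Path (Edge G) (segment p Q a) →
                  Σ (List (Fin n)) λ d → (Q ≡ split d) × Path (Arc D) (p ∷ d ++ [ a ])
  decodeSegment p [] a _ _ p≢a _ _ (e , _) =
    [] , refl , edge⇒arc (λ a≡p → p≢a refl (sym a≡p)) e , tt
  decodeSegment p (inj₂ _ ∷ _) a _ _ _ _ _ (() , _)
  decodeSegment p (inj₁ _ ∷ []) a _ _ _ _ _ (_ , () , _)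
  decodeSegment p (inj₁ _ ∷ inj₁ _ ∷ _) a _ _ _ _ _ (_ , () , _)
  -- The segment starts y_p x_b y_z; by mate-follows z = b, and the argument
  -- continues on the shorter segment y_b R x_a, preceded by the arc p → b.
  decodeSegment p (inj₁ b ∷ inj₂ z ∷ R) a a∉Q p∉Q _ u@(_ ∷ _ ∷ uR) mated (e , _ , w) =
    prepend (decodeSegment b R a (λ m → a∉Q (there (there m))) (λ m → b∉Q′ (there m)) (λ _ → b≢a) uR
              (λ b′ m → subst (λ y → MateStep (inj₂ y ∷ R ++ [ inj₁ a ]) b′) z≡b (mated′ b′ m))
              (subst (λ y → Path (Edge G) (inj₂ y ∷ R ++ [ inj₁ a ])) z≡b w))
    where
    b∉Q′ : inj₁ b ∉ inj₂ z ∷ R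
    b∉Q′ = Unique.Unique[x∷xs]⇒x∉xs u
    p≢b : p ≢ b
    p≢b p≡b = p∉Q (here (cong inj₁ p≡b))
    b≢a : b ≢ a
    b≢a b≡a = a∉Q (here (cong inj₁ (sym b≡a)))
    b∉rest : inj₁ b ∉ R ++ [ inj₁ a ]
    b∉rest m with ∈-++⁻ R m
    ... | inj₁ b∈R        = b∉Q′ (there b∈R)
    ... | inj₂ (here b≡a) = b≢a (inj₁-injective b≡a)
    mated′ : ∀ b′ → inj₁ b′ ∈ R → MateStep (inj₂ z ∷ R ++ [ inj₁ a ]) b′
    mated′ b′ b′∈R =
      Sum.map (λ s → step-drop (step-drop s (λ ())) b′≢b) (λ s → step-drop (step-drop s b′≢p) (λ ()))
        (mated b′ (there (there b′∈R)))
      where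
      b′≢b : inj₁ b′ ≢ inj₁ b
      b′≢b eq = b∉Q′ (there (subst (_∈ R) eq b′∈R))
      b′≢p : inj₂ b′ ≢ inj₂ p
      b′≢p eq = p∉Q (there (there (subst (λ v → inj₁ v ∈ R) (inj₂-injective eq) b′∈R)))
    z≡b : z ≡ b
    z≡b = mate-follows b∉rest p≢b (mated b (here refl))
    prepend : (Σ (List (Fin n)) λ d → (R ≡ split d) × Path (Arc D) (b ∷ d ++ [ a ])) →
              Σ (List (Fin n)) λ d → (inj₁ b ∷ inj₂ z ∷ R ≡ split d) × Path (Arc D) (p ∷ d ++ [ a ])
    prepend (d , R≡d , path) =
      b ∷ d , cong₂ (λ y l → inj₁ b ∷ inj₂ y ∷ l) z≡b R≡d , edge⇒arc (p≢b ∘ sym) e , path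

  record MatchedCycle (c : List V) : Set where
    field
      distinct : Unique c
      closed   : ClosedWalk (Edge G) c
      long     : 6 ≤ length c
      matched  : ∀ b → inj₁ b ∈ c → CycleEdge c (inj₁ b) (inj₂ b)
  open MatchedCycle

  matchedCycle-rotate : ∀ x y r → MatchedCycle (x ∷ y ∷ r) → MatchedCycle (y ∷ r ++ [ x ])
  matchedCycle-rotate x y r C = record
    { distinct = unique-resp-↭ rotation (distinct C)
    ; closed   = closedWalk-rotate x y r (closed C)
    ; long     = subst (6 ≤_) (↭-length rotation) (long C)
    ; matched  = λ b m → cycleEdge-rotate x y r (matched C b (∈-resp-↭ (↭-sym rotation) m))
    }
    where
    rotation : x ∷ y ∷ r ↭ y ∷ r ++ [ x ]
    rotation = ∷↭∷ʳ x (y ∷ r)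

  matchedCycle-reverse : ∀ x r → MatchedCycle (x ∷ r) → MatchedCycle (x ∷ reverse r)
  matchedCycle-reverse x r C = record
    { distinct = unique-resp-↭ reversal (distinct C)
    ; closed   = closedWalk-reverse edge-sym x r (closed C)
    ; long     = subst (6 ≤_) (↭-length reversal) (long C)
    ; matched  = λ b m → cycleEdge-reverse x r (matched C b (∈-resp-↭ (↭-sym reversal) m))
    }
    where
    reversal : x ∷ r ↭ x ∷ reverse r
    reversal = ↭-prep x (↭-sym (↭-reverse r))

  Decoding : List V → Set
  Decoding c = Σ (List (Fin n)) λ d → (c ↭ split d) × ClosedWalk (Arc D) d

  decoding-resp : ∀ {c c′} → c ↭ c′ → Decoding c′ → Decoding c
  decoding-resp c↭c′ (d , c′↭d , w) = d , ↭-trans c↭c′ c′↭d , w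

  decodeForward : ∀ a T → MatchedCycle (inj₁ a ∷ T) →
                  Step (inj₁ a ∷ T ++ [ inj₁ a ]) (inj₁ a) (inj₂ a) → Decoding (inj₁ a ∷ T)
  decodeForward a (v ∷ T) C (there s) =
    ⊥-elim (Unique.Unique[x∷xs]⇒x∉xs (distinct C) (step-∈-init (v ∷ T) s))
  decodeForward a (_ ∷ R) C here =
    close (decodeSegment a R a a∉R a∉R not-short (unique-++ʳ (inj₁ a ∷ inj₂ a ∷ []) (distinct C))
                         mated′ (proj₂ (closed C)))
    where
    a∉R : inj₁ a ∉ R
    a∉R m = Unique.Unique[x∷xs]⇒x∉xs (distinct C) (there m)
    not-short : R ≡ [] → a ≢ a
    not-short refl with s≤s (s≤s ()) ← long C
    mated′ : ∀ b → inj₁ b ∈ R → MateStep (inj₂ a ∷ R ++ [ inj₁ a ]) b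
    mated′ b b∈R = Sum.map (λ s → step-drop s (λ eq → a∉R (subst (_∈ R) eq b∈R))) (λ s → step-drop s (λ ()))
                           (matched C b (there (there b∈R)))
    close : (Σ (List (Fin n)) λ d → (R ≡ split d) × Path (Arc D) (a ∷ d ++ [ a ])) → Decoding (inj₁ a ∷ inj₂ a ∷ R)
    close (d , R≡d , w) = a ∷ d , ↭-reflexive (cong (λ l → inj₁ a ∷ inj₂ a ∷ l) R≡d) , w

  decodeFrom : ∀ a T → MatchedCycle (inj₁ a ∷ T) → Decoding (inj₁ a ∷ T)
  decodeFrom a T C with matched C a (here refl)
  ... | inj₁ forward  = decodeForward a T C forward
  ... | inj₂ backward =
    decoding-resp (↭-prep (inj₁ a) (↭-sym (↭-reverse T)))
      (decodeForward a (reverse T) (matchedCycle-reverse (inj₁ a) T C)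
        (subst (λ l → Step l (inj₁ a) (inj₂ a)) (closed-reverse (inj₁ a) T) (step-reverse backward)))

  decode : ∀ c → MatchedCycle c → Decoding c
  decode (inj₁ a ∷ T)           C = decodeFrom a T C
  decode (inj₂ _ ∷ [])          C with s≤s () ← long C
  decode (inj₂ _ ∷ inj₂ _ ∷ _)  C with () , _ ← closed C
  decode (inj₂ z ∷ inj₁ a ∷ T)  C =
    decoding-resp (∷↭∷ʳ (inj₂ z) (inj₁ a ∷ T))
      (decodeFrom a (T ++ [ inj₂ z ]) (matchedCycle-rotate (inj₂ z) (inj₁ a) T C))

  DirectedCycle : List (Fin n) → Set
  DirectedCycle d = (3 ≤ length d) × ClosedWalk (Arc D) d

  decodeAll : ∀ (cs : List (List V)) →
              (∀ c → c ∈ cs → Σ (List (Fin n)) λ d → (c ↭ split d) × DirectedCycle d) →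
              Σ (List (List (Fin n))) λ ds →
                (length ds ≡ length cs) × (concat cs ↭ split (concat ds)) × (∀ d → d ∈ ds → DirectedCycle d)
  decodeAll []       _   = [] , refl , ↭-refl , λ _ ()
  decodeAll (c ∷ cs) dec with d , c↭d , cyc ← dec c (here refl)
                            | ds , len , cs↭ds , cycs ← decodeAll cs (λ c′ m → dec c′ (there m)) =
    d ∷ ds ,
    cong suc len ,
    subst (c ++ concat cs ↭_) (sym (blowUp-++ _ d (concat ds))) (++⁺ c↭d cs↭ds) ,
    λ { _ (here refl) → cyc ; d′ (there m) → cycs d′ m }

  split-spanning⁻ : ∀ {vs l} → vs ↭ allVtx G → vs ↭ split l → l ↭ allFin n
  split-spanning⁻ {vs} {l} spans vs↭l =
    subst₂ _↭_ (xSide-blowUp _ l) (xSide-parts (allFin n) (allFin n)) (xSide-↭ (↭-trans (↭-sym vs↭l) spans))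

  unique-allVtx : Unique (allVtx G)
  unique-allVtx = Unique.++⁺ (Unique.map⁺ inj₁-injective (Unique.allFin⁺ n))
                             (Unique.map⁺ inj₂-injective (Unique.allFin⁺ n)) sides-disjoint
    where
    sides-disjoint : ∀ {v} → v ∈ map inj₁ (allFin n) × v ∈ map inj₂ (allFin n) → ⊥
    sides-disjoint (m₁ , m₂) with _ , _ , refl ← ∈-map⁻ inj₁ m₁ with _ , _ , () ← ∈-map⁻ inj₂ m₂

  lift : ∀ k → Has2FactorWith G k M → HasDirected2Factor D k
  lift k (cs , (len , spans , cycles) , containsM) = assemble (decodeAll cs decodeMember)
    where
    distinct-all : Unique (concat cs)
    distinct-all = unique-resp-↭ (↭-sym spans) unique-allVtx
    -- Each cycle contains its own matching edges, since the cycles are disjoint.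
    matchedMember : ∀ {c} → c ∈ cs → MatchedCycle c
    matchedMember {c} c∈cs = record
      { distinct = unique-concat distinct-all c∈cs
      ; closed   = proj₂ (cycles c c∈cs)
      ; long     = proj₁ (cycles c c∈cs)
      ; matched  = own-matching
      }
      where
      own-matching : ∀ b → inj₁ b ∈ c → CycleEdge c (inj₁ b) (inj₂ b)
      own-matching b b∈c with c′ , c′∈cs , e ← containsM b
                         with refl ← unique-concat-block distinct-all c′∈cs c∈cs (cycleEdge-∈ e) b∈c = e
    decodeMember : ∀ c → c ∈ cs → Σ (List (Fin n)) λ d → (c ↭ split d) × DirectedCycle d
    decodeMember c c∈cs with d , c↭d , w ← decode c (matchedMember c∈cs) =
      d , c↭d , half (length d) (subst (6 ≤_) (trans (↭-length c↭d) (length-blowUp _ d)) (proj₁ (cycles c c∈cs))) , w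
    assemble : (Σ (List (List (Fin n))) λ ds →
                 (length ds ≡ length cs) × (concat cs ↭ split (concat ds)) × (∀ d → d ∈ ds → DirectedCycle d)) →
               HasDirected2Factor D k
    assemble (ds , len′ , cs↭ds , dcycles) = ds , trans len′ len , split-spanning⁻ spans cs↭ds , dcycles

fromB : StatementB → StatementA
fromB B k k≥1 n n≥12k+3 D ore =
  Splitting.lift D k (B k k≥1 n n≥12k+3 (Splitting.G D) (Splitting.M D) (Splitting.σ₁₁-bound D ore))

proposition1 : StatementA ⇔ StatementB
proposition1 = mk⇔ fromA fromB
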